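{- Let $T$ be a tournament with a transmitter $s$ and no receiver. Then $T$ is quadrangular if and only if $\gamma(T-s)>2$, $T-s$ is out-quadrangular, and $\delta^{+}(T-s)\geq 2$.
   Context: A tournament $T$ is a loopless digraph in which for each pair of distinct vertices $u\neq v$ exactly one of $(u,v)$, $(v,u)$ is an arc; $u\rightarrow v$ means $(u,v)$ is an arc. $O(v)=\{u:v\rightarrow u\}$, $I(v)=\{u:u\rightarrow v\}$. A digraph is quadrangular if for all distinct vertices $u,v$, $|O(u)\cap O(v)|\neq 1$ and $|I(u)\cap I(v)|\neq 1$; it is out-quadrangular if $|O(u)\cap O(v)|\neq1$ for all distinct $u,v$. A transmitter dominates all other vertices; a receiver is dominated by all other vertices. $T-s$ is the subtournament induced on $V(T)\setminus\{s\}$. $\delta^{+}(D)$ is the minimum out-degree $|O(v)|$ over vertices of $D$. A dominating set of $D$ is a set $S$ of vertices such that every vertex is in $S$ or dominated by some vertex in $S$; $\gamma(D)$ is the minimum size of a dominating set. -}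

module Defs where

open import Data.Nat using (ℕ; suc; _≤_; _<_)
open import Data.Bool using (Bool; true; false; not)
open import Data.Fin using (Fin; punchIn)
open import Data.Fin.Subset using (Subset; _∈_; _∩_; ∣_∣)
open import Data.Vec using (tabulate)
open import Data.Product using (_×_; Σ; ∃)
open import Data.Sum using (_⊎_)
open import Relation.Nullary using (¬_)
open import Relation.Binary.PropositionalEquality using (_≡_; _≢_)

Digraph : ℕ → Set
Digraph n = Fin n → Fin n → Bool

_⇒_within_ : ∀ {n} → Fin n → Fin n → Digraph n → Set
u ⇒ v within E = E u v ≡ true

IsTournament : ∀ {n} → Digraph n → Set
IsTournament {n} E =
  (∀ (u : Fin n) → E u u ≡ false) ×
  (∀ (u v : Fin n) → u ≢ v → E v u ≡ not (E u v))

Out : ∀ {n} → Digraph n → Fin n → Subset n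
Out E v = tabulate (λ u → E v u)

In : ∀ {n} → Digraph n → Fin n → Subset n
In E v = tabulate (λ u → E u v)

IsQuadrangular : ∀ {n} → Digraph n → Set
IsQuadrangular {n} E = ∀ (u v : Fin n) → u ≢ v →
  (∣ Out E u ∩ Out E v ∣ ≢ 1) × (∣ In E u ∩ In E v ∣ ≢ 1)

IsOutQuadrangular : ∀ {n} → Digraph n → Set
IsOutQuadrangular {n} E = ∀ (u v : Fin n) → u ≢ v → ∣ Out E u ∩ Out E v ∣ ≢ 1

IsTransmitter : ∀ {n} → Digraph n → Fin n → Set
IsTransmitter {n} E s = ∀ (v : Fin n) → v ≢ s → E s v ≡ true

IsReceiver : ∀ {n} → Digraph n → Fin n → Set
IsReceiver {n} E r = ∀ (v : Fin n) → v ≢ r → E v r ≡ true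

-- T - s : induced subdigraph on V \ {s}, vertices re-indexed via punchIn s.
delete : ∀ {n} → Digraph (suc n) → Fin (suc n) → Digraph n
delete E s u v = E (punchIn s u) (punchIn s v)

IsDominatingSet : ∀ {n} → Digraph n → Subset n → Set
IsDominatingSet {n} E S = ∀ (v : Fin n) → v ∈ S ⊎ (∃ λ u → u ∈ S × E u v ≡ true)

-- γ(D) > k : the minimum size of a dominating set exceeds k,
-- i.e. every dominating set has more than k elements.
γ>_ : ∀ {n} → ℕ → Digraph n → Set
γ>_ {n} k E = ∀ (S : Subset n) → IsDominatingSet E S → k < ∣ S ∣

δ⁺≥_ : ∀ {n} → ℕ → Digraph n → Set
δ⁺≥_ {n} k E = ∀ (v : Fin n) → k ≤ ∣ Out E v ∣

{-# OPTIONS --safe #-}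
module Submission where

-- Since s beats every other vertex and is beaten by none, deleting it leaves each |O(u) ∩ O(v)|
-- unchanged and lowers each |I(u) ∩ I(v)| by exactly one, while |O(s) ∩ O(v)| is the out-degree
-- of v in T - s and |I(s) ∩ I(v)| = 0. Hence T is quadrangular iff T - s is out-quadrangular, has
-- no vertex of out-degree 1, and any two distinct vertices of T - s have a common in-neighbour;
-- out-degree 0 is excluded because such a vertex would be a receiver of T. In a tournament,
-- γ > 2 says exactly that every set of at most two vertices has a common in-neighbour, because
-- {u, v} dominates every vertex except those beating both u and v.

open import Defs
open import Data.Bool using (Bool; true; false; not; _∧_)
open import Data.Bool.Properties using () renaming (_≟_ to _≟ᵇ_)
open import Data.Empty using (⊥-elim)
open import Data.Fin using (Fin; zero; suc; punchIn; punchOut; _≟_)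
open import Data.Fin.Properties using (any?; punchIn-injective; punchInᵢ≢i; punchIn-punchOut; ¬Fin0)
open import Data.Fin.Subset using (Subset; inside; outside; _∈_; _∩_; _∪_; ⁅_⁆; ∣_∣; Nonempty; Empty)
open import Data.Fin.Subset.Properties
  using (x∈p⇒∣p-x∣<∣p∣; x∈p∧x≢y⇒x∈p-y; nonempty?; Empty-unique; ∣⊥∣≡0; x∈⁅x⁆; ∣⁅x⁆∣≡1;
         x∈p∪q⁺; x∈p∩q⁺; x∈p∩q⁻; ∩-comm)
open import Data.Nat using (ℕ; zero; suc; _+_; _≤_; _<_; z≤n; s≤s)
open import Data.Nat.Properties
  using (≤-trans; ≤-<-trans; +-suc; +-monoʳ-≤; n≤1+n; n>0⇒n≢0; n≢0⇒n>0; ≤∧≢⇒<; >⇒≢; ≤⇒≯; suc-injective)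
open import Data.Product using (_×_; ∃; _,_; proj₁; proj₂)
open import Data.Sum using (_⊎_; inj₁; inj₂; [_,_]′)
open import Data.Vec using (_∷_; []; tabulate)
open import Data.Vec.Properties using (lookup∘tabulate; tabulate-cong; []=⇒lookup; lookup⇒[]=)
open import Function using (_∘_; id)
open import Function.Bundles using (_⇔_; mk⇔; Equivalence)
open import Relation.Nullary using (¬_; yes; no; contradiction)
open import Relation.Nullary.Decidable using (_×-dec_)
open import Relation.Binary.PropositionalEquality
  using (_≡_; _≢_; refl; sym; trans; cong; cong₂; subst; module ≡-Reasoning)

private variable
  n : ℕ

≡-or-punchIn : ∀ (s w : Fin (suc n)) → w ≡ s ⊎ ∃ λ w′ → w ≡ punchIn s w′
≡-or-punchIn s w with w ≟ s
... | yes w≡s = inj₁ w≡s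
... | no w≢s = inj₂ (punchOut (w≢s ∘ sym) , sym (punchIn-punchOut (w≢s ∘ sym)))

∣x∷p∣≡∣x∷q∣ : ∀ x {p q : Subset n} → ∣ p ∣ ≡ ∣ q ∣ → ∣ x ∷ p ∣ ≡ ∣ x ∷ q ∣
∣x∷p∣≡∣x∷q∣ true  eq = cong suc eq
∣x∷p∣≡∣x∷q∣ false eq = eq

∣x∷y∷p∣≡∣y∷x∷p∣ : ∀ x y (p : Subset n) → ∣ x ∷ y ∷ p ∣ ≡ ∣ y ∷ x ∷ p ∣
∣x∷y∷p∣≡∣y∷x∷p∣ true  true  p = refl
∣x∷y∷p∣≡∣y∷x∷p∣ true  false p = refl
∣x∷y∷p∣≡∣y∷x∷p∣ false true  p = refl
∣x∷y∷p∣≡∣y∷x∷p∣ false false p = refl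

∣∩∣-punchIn : ∀ (s : Fin (suc n)) (f g : Fin (suc n) → Bool) →
  ∣ tabulate f ∩ tabulate g ∣ ≡ ∣ (f s ∧ g s) ∷ tabulate (f ∘ punchIn s) ∩ tabulate (g ∘ punchIn s) ∣
∣∩∣-punchIn zero f g = refl
∣∩∣-punchIn {suc n} (suc s) f g = begin
  ∣ (f zero ∧ g zero) ∷ tabulate (f ∘ suc) ∩ tabulate (g ∘ suc) ∣
    ≡⟨ ∣x∷p∣≡∣x∷q∣ (f zero ∧ g zero) {tabulate (f ∘ suc) ∩ tabulate (g ∘ suc)}
         {(f (suc s) ∧ g (suc s)) ∷ rest}
         (∣∩∣-punchIn s (f ∘ suc) (g ∘ suc)) ⟩
  ∣ (f zero ∧ g zero) ∷ (f (suc s) ∧ g (suc s)) ∷ rest ∣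
    ≡⟨ ∣x∷y∷p∣≡∣y∷x∷p∣ (f zero ∧ g zero) (f (suc s) ∧ g (suc s)) rest ⟩
  ∣ (f (suc s) ∧ g (suc s)) ∷ (f zero ∧ g zero) ∷ rest ∣ ∎
  where
  open ≡-Reasoning
  rest : Subset n
  rest = tabulate (f ∘ suc ∘ punchIn s) ∩ tabulate (g ∘ suc ∘ punchIn s)

tabulate-∩ : ∀ (f g : Fin n → Bool) → tabulate f ∩ tabulate g ≡ tabulate (λ x → f x ∧ g x)
tabulate-∩ {zero}  f g = refl
tabulate-∩ {suc n} f g = cong (f zero ∧ g zero ∷_) (tabulate-∩ (f ∘ suc) (g ∘ suc))

∈-tabulate⁺ : ∀ (f : Fin n → Bool) {x} → f x ≡ true → x ∈ tabulate f
∈-tabulate⁺ f {x} fx = lookup⇒[]= x (tabulate f) (trans (lookup∘tabulate f x) fx)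

∈-tabulate⁻ : ∀ (f : Fin n → Bool) {x} → x ∈ tabulate f → f x ≡ true
∈-tabulate⁻ f {x} x∈ = trans (sym (lookup∘tabulate f x)) ([]=⇒lookup x∈)

x∈p⇒∣p∣≢0 : ∀ {p : Subset n} {x} → x ∈ p → ∣ p ∣ ≢ 0
x∈p⇒∣p∣≢0 x∈p = n>0⇒n≢0 (≤-<-trans z≤n (x∈p⇒∣p-x∣<∣p∣ x∈p))

∣p∣≢0⇒Nonempty : ∀ (p : Subset n) → ∣ p ∣ ≢ 0 → Nonempty p
∣p∣≢0⇒Nonempty {n} p ∣p∣≢0 with nonempty? p
... | yes nonempty = nonempty
... | no empty = contradiction (trans (cong ∣_∣ (Empty-unique empty)) (∣⊥∣≡0 n)) ∣p∣≢0

∣p∪q∣≤∣p∣+∣q∣ : ∀ (p q : Subset n) → ∣ p ∪ q ∣ ≤ ∣ p ∣ + ∣ q ∣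
∣p∪q∣≤∣p∣+∣q∣ [] [] = z≤n
∣p∪q∣≤∣p∣+∣q∣ (outside ∷ p) (outside ∷ q) = ∣p∪q∣≤∣p∣+∣q∣ p q
∣p∪q∣≤∣p∣+∣q∣ (inside  ∷ p) (outside ∷ q) = s≤s (∣p∪q∣≤∣p∣+∣q∣ p q)
∣p∪q∣≤∣p∣+∣q∣ (outside ∷ p) (inside  ∷ q) =
  subst (suc ∣ p ∪ q ∣ ≤_) (sym (+-suc ∣ p ∣ ∣ q ∣)) (s≤s (∣p∪q∣≤∣p∣+∣q∣ p q))
∣p∪q∣≤∣p∣+∣q∣ (inside  ∷ p) (inside  ∷ q) =
  s≤s (≤-trans (∣p∪q∣≤∣p∣+∣q∣ p q) (+-monoʳ-≤ ∣ p ∣ (n≤1+n ∣ q ∣)))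

∣⁅x⁆∪⁅y⁆∣≤2 : ∀ (x y : Fin n) → ∣ ⁅ x ⁆ ∪ ⁅ y ⁆ ∣ ≤ 2
∣⁅x⁆∪⁅y⁆∣≤2 x y =
  subst (∣ ⁅ x ⁆ ∪ ⁅ y ⁆ ∣ ≤_) (cong₂ _+_ (∣⁅x⁆∣≡1 x) (∣⁅x⁆∣≡1 y)) (∣p∪q∣≤∣p∣+∣q∣ ⁅ x ⁆ ⁅ y ⁆)

escapesPairs⇒2<∣p∣ : ∀ {p : Subset n} → Fin n → (∀ a b → ∃ λ x → x ∈ p × x ≢ a × x ≢ b) → 2 < ∣ p ∣
escapesPairs⇒2<∣p∣ x₀ escape =
  let a , a∈p , _ = escape x₀ x₀
      b , b∈p , b≢a , _ = escape a a
      c , c∈p , c≢a , c≢b = escape a b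
      b∈p-a = x∈p∧x≢y⇒x∈p-y b∈p b≢a
      c∈p-a-b = x∈p∧x≢y⇒x∈p-y (x∈p∧x≢y⇒x∈p-y c∈p c≢a) c≢b
  in ≤-<-trans (≤-<-trans (≤-<-trans z≤n (x∈p⇒∣p-x∣<∣p∣ c∈p-a-b))
                           (x∈p⇒∣p-x∣<∣p∣ b∈p-a))
               (x∈p⇒∣p-x∣<∣p∣ a∈p)

CommonInNeighbour : Digraph n → Fin n → Fin n → Set
CommonInNeighbour E u v = ∃ λ w → w ⇒ u within E × w ⇒ v within E

DominatedBy : Digraph n → Subset n → Fin n → Set
DominatedBy E S w = w ∈ S ⊎ ∃ λ x → x ∈ S × x ⇒ w within E

QuadrangularPair : Digraph n → Fin n → Fin n → Set
QuadrangularPair E u v = (∣ Out E u ∩ Out E v ∣ ≢ 1) × (∣ In E u ∩ In E v ∣ ≢ 1)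

quadrangularPair-sym : ∀ (E : Digraph n) u v → QuadrangularPair E u v → QuadrangularPair E v u
quadrangularPair-sym E u v (out≢1 , in≢1) =
  out≢1 ∘ trans (cong ∣_∣ (∩-comm (Out E u) (Out E v))) ,
  in≢1 ∘ trans (cong ∣_∣ (∩-comm (In E u) (In E v)))

commonInNeighbour⇔∣In∩In∣≢0 : ∀ (E : Digraph n) u v → CommonInNeighbour E u v ⇔ ∣ In E u ∩ In E v ∣ ≢ 0
commonInNeighbour⇔∣In∩In∣≢0 E u v = mk⇔
  (λ (w , w⇒u , w⇒v) → x∈p⇒∣p∣≢0 {p = In E u ∩ In E v}
     (x∈p∩q⁺ (∈-tabulate⁺ (λ x → E x u) w⇒u , ∈-tabulate⁺ (λ x → E x v) w⇒v)))
  (λ ∣I∩I∣≢0 → let w , w∈I∩I = ∣p∣≢0⇒Nonempty (In E u ∩ In E v) ∣I∩I∣≢0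
                   w∈Iu , w∈Iv = x∈p∩q⁻ (In E u) (In E v) w∈I∩I
               in w , ∈-tabulate⁻ (λ x → E x u) w∈Iu , ∈-tabulate⁻ (λ x → E x v) w∈Iv)

delete-isTournament : ∀ {E : Digraph (suc n)} (s : Fin (suc n)) → IsTournament E → IsTournament (delete E s)
delete-isTournament s (loopless , reverse) =
  (λ u → loopless (punchIn s u)) ,
  (λ u v u≢v → reverse (punchIn s u) (punchIn s v) (u≢v ∘ punchIn-injective s u v))

module _ {E : Digraph n} (tournament : IsTournament E) where

  arc⇒≢ : ∀ {u v} → u ⇒ v within E → u ≢ v
  arc⇒≢ {u} u⇒u refl with () ← trans (sym u⇒u) (proj₁ tournament u)

  arc-asym : ∀ {u v} → u ⇒ v within E → ¬ (v ⇒ u within E)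
  arc-asym {u} {v} u⇒v v⇒u
    with () ← trans (sym v⇒u) (trans (proj₂ tournament u v (arc⇒≢ u⇒v)) (cong not u⇒v))

  arc-or-reverse : ∀ {u v} → u ≢ v → u ⇒ v within E ⊎ v ⇒ u within E
  arc-or-reverse {u} {v} u≢v with E u v in u→v
  ... | true  = inj₁ refl
  ... | false = inj₂ (trans (proj₂ tournament u v u≢v) (cong not u→v))

  dominatedByPair-or-commonInNeighbour : ∀ u v w →
    DominatedBy E (⁅ u ⁆ ∪ ⁅ v ⁆) w ⊎ (w ⇒ u within E × w ⇒ v within E)
  dominatedByPair-or-commonInNeighbour u v w with w ≟ u | w ≟ v
  ... | yes refl | _ = inj₁ (inj₁ (x∈p∪q⁺ (inj₁ (x∈⁅x⁆ u))))
  ... | no _ | yes refl = inj₁ (inj₁ (x∈p∪q⁺ (inj₂ (x∈⁅x⁆ v))))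
  ... | no w≢u | no w≢v with arc-or-reverse w≢u | arc-or-reverse w≢v
  ... | inj₂ u⇒w | _ = inj₁ (inj₂ (u , x∈p∪q⁺ (inj₁ (x∈⁅x⁆ u)) , u⇒w))
  ... | inj₁ _ | inj₂ v⇒w = inj₁ (inj₂ (v , x∈p∪q⁺ (inj₂ (x∈⁅x⁆ v)) , v⇒w))
  ... | inj₁ w⇒u | inj₁ w⇒v = inj₂ (w⇒u , w⇒v)

  γ>2⇒commonInNeighbour : (γ> 2) E → ∀ u v → CommonInNeighbour E u v
  γ>2⇒commonInNeighbour γ>2 u v with any? (λ w → (E w u ≟ᵇ true) ×-dec (E w v ≟ᵇ true))
  ... | yes common = common
  ... | no ¬common = ⊥-elim (≤⇒≯ (∣⁅x⁆∪⁅y⁆∣≤2 u v) (γ>2 (⁅ u ⁆ ∪ ⁅ v ⁆) dominating))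
    where
    dominating : IsDominatingSet E (⁅ u ⁆ ∪ ⁅ v ⁆)
    dominating w = [ id , (λ w⇒uv → contradiction (w , w⇒uv) ¬common) ]′
                     (dominatedByPair-or-commonInNeighbour u v w)

  commonInNeighbour⇒γ>2 : Fin n → (∀ u v → CommonInNeighbour E u v) → (γ> 2) E
  commonInNeighbour⇒γ>2 x₀ common S dominating = escapesPairs⇒2<∣p∣ x₀ escape
    where
    -- A common in-neighbour of a and b is neither a nor b, nor beaten by them.
    escape : ∀ a b → ∃ λ x → x ∈ S × x ≢ a × x ≢ b
    escape a b with common a b
    ... | w , w⇒a , w⇒b with dominating w
    ... | inj₁ w∈S = w , w∈S , arc⇒≢ w⇒a , arc⇒≢ w⇒b
    ... | inj₂ (x , x∈S , x⇒w) =
      x , x∈S , (λ { refl → arc-asym x⇒w w⇒a }) , (λ { refl → arc-asym x⇒w w⇒b })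

  outNeighbour⇒commonInNeighbour : (∀ u → ∃ λ x → u ⇒ x within E) →
    (∀ u v → u ≢ v → CommonInNeighbour E u v) → ∀ u v → CommonInNeighbour E u v
  outNeighbour⇒commonInNeighbour outNeighbour common u v with u ≟ v
  ... | no u≢v = common u v u≢v
  ... | yes refl with outNeighbour u
  ... | x , u⇒x with common u x (arc⇒≢ u⇒x)
  ... | w , w⇒u , _ = w , w⇒u , w⇒u

module RemovingTransmitter {m} {T : Digraph (suc m)} {s : Fin (suc m)}
  (tournament : IsTournament T) (transmitter : IsTransmitter T s) where

  T-s : Digraph m
  T-s = delete T s

  ι : Fin m → Fin (suc m)
  ι = punchIn s

  T-s-isTournament : IsTournament T-s
  T-s-isTournament = delete-isTournament s tournament

  s⇒ι : ∀ u → s ⇒ ι u within T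
  s⇒ι u = transmitter (ι u) (punchInᵢ≢i s u)

  ↛s : ∀ w → T w s ≡ false
  ↛s w with w ≟ s
  ... | yes refl = proj₁ tournament s
  ... | no w≢s = trans (proj₂ tournament s w (w≢s ∘ sym)) (cong not (transmitter w w≢s))

  ∣Out∩Out∣-delete : ∀ u v → ∣ Out T (ι u) ∩ Out T (ι v) ∣ ≡ ∣ Out T-s u ∩ Out T-s v ∣
  ∣Out∩Out∣-delete u v =
    trans (∣∩∣-punchIn s (T (ι u)) (T (ι v)))
          (cong (λ b → ∣ b ∧ T (ι v) s ∷ Out T-s u ∩ Out T-s v ∣) (↛s (ι u)))

  ∣In∩In∣-delete : ∀ u v → ∣ In T (ι u) ∩ In T (ι v) ∣ ≡ suc ∣ In T-s u ∩ In T-s v ∣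
  ∣In∩In∣-delete u v =
    trans (∣∩∣-punchIn s (λ w → T w (ι u)) (λ w → T w (ι v)))
          (cong₂ (λ a b → ∣ a ∧ b ∷ In T-s u ∩ In T-s v ∣) (s⇒ι u) (s⇒ι v))

  ∣Out-s∩Out∣ : ∀ v → ∣ Out T s ∩ Out T (ι v) ∣ ≡ ∣ Out T-s v ∣
  ∣Out-s∩Out∣ v = begin
    ∣ Out T s ∩ Out T (ι v) ∣
      ≡⟨ ∣∩∣-punchIn s (T s) (T (ι v)) ⟩
    ∣ (T s s ∧ T (ι v) s) ∷ tabulate (T s ∘ ι) ∩ Out T-s v ∣
      ≡⟨ cong (λ b → ∣ b ∧ T (ι v) s ∷ tabulate (T s ∘ ι) ∩ Out T-s v ∣) (proj₁ tournament s) ⟩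
    ∣ tabulate (T s ∘ ι) ∩ Out T-s v ∣
      ≡⟨ cong ∣_∣ (tabulate-∩ (T s ∘ ι) (T-s v)) ⟩
    ∣ tabulate (λ w → T s (ι w) ∧ T-s v w) ∣
      ≡⟨ cong ∣_∣ (tabulate-cong (λ w → cong (_∧ T-s v w) (s⇒ι w))) ⟩
    ∣ Out T-s v ∣ ∎
    where open ≡-Reasoning

  ∣In-s∩In∣ : ∀ v → ∣ In T s ∩ In T (ι v) ∣ ≡ 0
  ∣In-s∩In∣ v = trans (cong ∣_∣ (Empty-unique empty)) (∣⊥∣≡0 (suc m))
    where
    empty : Empty (In T s ∩ In T (ι v))
    empty (w , w∈) with () ←
      trans (sym (∈-tabulate⁻ (λ x → T x s) (proj₁ (x∈p∩q⁻ (In T s) (In T (ι v)) w∈)))) (↛s w)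

  receiverless⇒outNeighbour : ¬ (∃ λ r → IsReceiver T r) → ∀ v → ∃ λ x → v ⇒ x within T-s
  receiverless⇒outNeighbour no-receiver v with any? (λ x → T-s v x ≟ᵇ true)
  ... | yes outNeighbour = outNeighbour
  ... | no ¬outNeighbour = contradiction (ι v , receiver) no-receiver
    where
    receiver : IsReceiver T (ι v)
    receiver w w≢ιv with ≡-or-punchIn s w
    ... | inj₁ refl = s⇒ι v
    ... | inj₂ (w′ , refl) =
      [ (λ v⇒w′ → contradiction (w′ , v⇒w′) ¬outNeighbour) , id ]′
        (arc-or-reverse T-s-isTournament (w≢ιv ∘ cong ι ∘ sym))

  pairWith-s : (∀ v → ∣ Out T-s v ∣ ≢ 1) → ∀ v → QuadrangularPair T s (ι v)
  pairWith-s deg≢1 v = deg≢1 v ∘ trans (sym (∣Out-s∩Out∣ v)) , (λ ()) ∘ trans (sym (∣In-s∩In∣ v))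

  DeletionCriterion : Set
  DeletionCriterion =
    IsOutQuadrangular T-s × (∀ v → ∣ Out T-s v ∣ ≢ 1) × (∀ u v → u ≢ v → CommonInNeighbour T-s u v)

  quadrangular⇔ : IsQuadrangular T ⇔ DeletionCriterion
  quadrangular⇔ = mk⇔ to from
    where
    ι-≢ : ∀ {u v} → u ≢ v → ι u ≢ ι v
    ι-≢ u≢v = u≢v ∘ punchIn-injective s _ _

    to : IsQuadrangular T → DeletionCriterion
    to quad =
      (λ u v u≢v → proj₁ (quad (ι u) (ι v) (ι-≢ u≢v)) ∘ trans (∣Out∩Out∣-delete u v)) ,
      (λ v → proj₁ (quad s (ι v) (punchInᵢ≢i s v ∘ sym)) ∘ trans (∣Out-s∩Out∣ v)) ,
      (λ u v u≢v → Equivalence.from (commonInNeighbour⇔∣In∩In∣≢0 T-s u v)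
                     (proj₂ (quad (ι u) (ι v) (ι-≢ u≢v)) ∘ trans (∣In∩In∣-delete u v) ∘ cong suc))

    from : DeletionCriterion → IsQuadrangular T
    from (outQuad , deg≢1 , common) u v u≢v with ≡-or-punchIn s u | ≡-or-punchIn s v
    ... | inj₁ refl | inj₁ refl = contradiction refl u≢v
    ... | inj₁ refl | inj₂ (v′ , refl) = pairWith-s deg≢1 v′
    ... | inj₂ (u′ , refl) | inj₁ refl = quadrangularPair-sym T s (ι u′) (pairWith-s deg≢1 u′)
    ... | inj₂ (u′ , refl) | inj₂ (v′ , refl) =
      outQuad u′ v′ u′≢v′ ∘ trans (sym (∣Out∩Out∣-delete u′ v′)) ,
      Equivalence.to (commonInNeighbour⇔∣In∩In∣≢0 T-s u′ v′) (common u′ v′ u′≢v′)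
        ∘ suc-injective ∘ trans (sym (∣In∩In∣-delete u′ v′))
      where
      u′≢v′ : u′ ≢ v′
      u′≢v′ = u≢v ∘ cong ι

receiverless⇒Fin : ∀ {m} {E : Digraph (suc m)} → ¬ (∃ λ r → IsReceiver E r) → Fin m
receiverless⇒Fin {zero} no-receiver =
  ⊥-elim (no-receiver (zero , λ v v≢0 → ⊥-elim (¬Fin0 (punchOut (v≢0 ∘ sym)))))
receiverless⇒Fin {suc m} _ = zero

theorem2 : ∀ {m : ℕ} (T : Digraph (suc m)) (s : Fin (suc m)) →
    IsTournament T → IsTransmitter T s → ¬ (∃ λ r → IsReceiver T r) →
    IsQuadrangular T ⇔
    ((γ> 2) (delete T s) × IsOutQuadrangular (delete T s) × (δ⁺≥ 2) (delete T s))
theorem2 T s tournament transmitter no-receiver = mk⇔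
  (λ quad → let outQuad , deg≢1 , common = Equivalence.to quadrangular⇔ quad in
    commonInNeighbour⇒γ>2 T-s-isTournament (receiverless⇒Fin no-receiver)
      (outNeighbour⇒commonInNeighbour T-s-isTournament outNeighbour common) ,
    outQuad ,
    λ v → ≤∧≢⇒< (n≢0⇒n>0 (deg≢0 v)) (deg≢1 v ∘ sym))
  (λ (γ>2 , outQuad , δ⁺≥2) → Equivalence.from quadrangular⇔
    (outQuad , (λ v → >⇒≢ (δ⁺≥2 v)) , λ u v _ → γ>2⇒commonInNeighbour T-s-isTournament γ>2 u v))
  where
  open RemovingTransmitter tournament transmitter

  outNeighbour : ∀ v → ∃ λ x → v ⇒ x within T-s
  outNeighbour = receiverless⇒outNeighbour no-receiver

  deg≢0 : ∀ v → ∣ Out T-s v ∣ ≢ 0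
  deg≢0 v = let x , v⇒x = outNeighbour v in x∈p⇒∣p∣≢0 {p = Out T-s v} (∈-tabulate⁺ (T-s v) v⇒x)
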